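{- For every graph $G$ on $n$ vertices other than the empty graph and the complete graph, \[\operatorname{scp}(G)+\operatorname{scp}(\overline{G})\geq 3n-3,\] and equality holds if and only if $G$ or $\overline{G}$ contains a clique of size $n-1$.
   Context: A clique partition of a graph $G$ is a family $\mathcal{C}$ of cliques (sets of mutually adjacent vertices) of $G$ such that the two endpoints of every edge of $G$ lie together in exactly one member of $\mathcal{C}$. The sigma clique partition number $\operatorname{scp}(G)$ is the minimum of $\sum_{C\in\mathcal{C}}|C|$ over all clique partitions $\mathcal{C}$ of $G$. $\overline{G}$ denotes the complement of $G$; the empty graph means the graph on $n$ vertices with no edges. -}

module Defs where

open import Data.Bool using (Bool; true; false; not; _∧_; if_then_else_)
open import Data.Nat using (ℕ; zero; suc; _+_; _≤_)
open import Data.Fin using (Fin; _≟_)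
open import Data.Fin.Subset using (Subset; ∣_∣)
open import Data.Vec using (lookup)
open import Data.List using (List; []; _∷_; length; filterᵇ; map)
open import Data.Nat.ListAction using (sum)
open import Data.Product using (Σ; _×_; ∃)
open import Relation.Nullary using (¬_; does; yes; no)
open import Relation.Binary.PropositionalEquality using (_≡_; _≢_; refl; cong)
open import Data.Empty using (⊥-elim)
open import Data.List.Relation.Unary.All using (All)

record Graph (n : ℕ) : Set where
  field
    adj    : Fin n → Fin n → Bool
    sym    : ∀ i j → adj i j ≡ adj j i
    irrefl : ∀ i → adj i i ≡ false
open Graph public

_∈ₛ_ : {n : ℕ} → Fin n → Subset n → Set
i ∈ₛ C = lookup C i ≡ true

Edge : {n : ℕ} → Graph n → Fin n → Fin n → Set
Edge G i j = adj G i j ≡ true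

complAdj : {n : ℕ} → Graph n → Fin n → Fin n → Bool
complAdj G i j = if does (i ≟ j) then false else not (adj G i j)

private
  complSym : {n : ℕ} (G : Graph n) → ∀ i j → complAdj G i j ≡ complAdj G j i
  complSym G i j with i ≟ j | j ≟ i
  ... | yes refl | yes _ = refl
  ... | yes refl | no j≢i = ⊥-elim (j≢i refl)
  ... | no i≢j | yes refl = ⊥-elim (i≢j refl)
  ... | no _ | no _ = cong not (sym G i j)

  complIrrefl : {n : ℕ} (G : Graph n) → ∀ i → complAdj G i i ≡ false
  complIrrefl G i with i ≟ i
  ... | yes _ = refl
  ... | no i≢i = ⊥-elim (i≢i refl)

complement : {n : ℕ} → Graph n → Graph n
complement G = record { adj = complAdj G ; sym = complSym G ; irrefl = complIrrefl G }

IsEmptyGraph : {n : ℕ} → Graph n → Set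
IsEmptyGraph {n} G = ∀ (i j : Fin n) → adj G i j ≡ false

IsCompleteGraph : {n : ℕ} → Graph n → Set
IsCompleteGraph {n} G = ∀ (i j : Fin n) → i ≢ j → adj G i j ≡ true

IsClique : {n : ℕ} → Graph n → Subset n → Set
IsClique {n} G C = ∀ (i j : Fin n) → i ∈ₛ C → j ∈ₛ C → i ≢ j → Edge G i j

HasCliqueOfSize : {n : ℕ} → Graph n → ℕ → Set
HasCliqueOfSize {n} G k = Σ (Subset n) λ C → IsClique G C × ∣ C ∣ ≡ k

countContaining : {n : ℕ} → List (Subset n) → Fin n → Fin n → ℕ
countContaining 𝒞 i j = length (filterᵇ (λ C → lookup C i ∧ lookup C j) 𝒞)

record IsCliquePartition {n : ℕ} (G : Graph n) (𝒞 : List (Subset n)) : Set where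
  field
    allCliques : All (IsClique G) 𝒞
    exactlyOne : ∀ (i j : Fin n) → Edge G i j → countContaining 𝒞 i j ≡ 1

weight : {n : ℕ} → List (Subset n) → ℕ
weight 𝒞 = sum (map ∣_∣ 𝒞)

IsScp : {n : ℕ} → Graph n → ℕ → Set
IsScp {n} G k =
  (Σ (List (Subset n)) λ 𝒞 → IsCliquePartition G 𝒞 × weight 𝒞 ≡ k)
  × (∀ (𝒞 : List (Subset n)) → IsCliquePartition G 𝒞 → k ≤ weight 𝒞)

-- If P and Q are clique partitions of G and of its complement, every pair of vertices lies in
-- exactly one block of P ++ Q, and the total weight is the sum over vertices v of the number r(v)
-- of blocks through v. Take a block C₀ of maximum size m; it misses a vertex w because G is
-- neither empty nor complete. A vertex outside C₀ is joined to the m points of C₀ by m distinct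
-- blocks, so r(v) ≥ m, and a vertex of C₀ lies on C₀ and on the block through w, so r(v) ≥ 2.
-- If C₀ misses only w this gives 3(n − 1). If it misses two vertices d and e, every v ∈ C₀ needs
-- blocks to d and to e, and these coincide for at most one v because the block through d and e
-- meets C₀ at most once; for m ≥ 3 this gives 3n − 1, while for m ≤ 2 all blocks are pairs and
-- r(v) = n − 1 ≥ 3. Conversely, a clique C missing only v yields the partitions C together with
-- the edges at v, and the non-edges at v, of total weight (n − 1) + 2(n − 1).

module Submission where

open import Defs
open import Data.Nat using (ℕ; _+_; _*_; _∸_; _≤_)
open import Data.Product using (_×_)
open import Data.Sum using (_⊎_)
open import Function.Bundles using (_⇔_; mk⇔)
open import Relation.Nullary using (¬_)
open import Relation.Binary.PropositionalEquality using (_≡_)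

open import Data.Bool using (Bool; true; false; not; _∧_; _∨_; if_then_else_)
open import Data.Bool.Properties using (not-involutive; ¬-not; ∧-identityʳ)
import Data.Bool.Properties as Boolₚ
open import Data.Nat using (zero; suc; _<_; z≤n; s≤s; _≤?_) renaming (_≟_ to _≟ℕ_)
open import Data.Nat.Properties hiding (_≟_)
open import Data.Nat.ListAction using () renaming (sum to sumˡ)
open import Data.Nat.Tactic.RingSolver using (solve-∀)
open import Data.Fin using (Fin; zero; suc; _≟_)
import Data.Fin.Properties as Finₚ
open import Data.Fin.Properties using (¬∀⟶∃¬; all?)
open import Data.Fin.Subset using (Subset; ∣_∣)
open import Data.Vec using (lookup; []; _∷_)
import Data.Vec as Vec
open import Data.Vec.Properties using (lookup∘tabulate)
open import Data.List using (List; []; _∷_; _++_; map; length; filterᵇ; tabulate)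
open import Data.List.Membership.Propositional using (_∈_)
open import Data.List.Relation.Unary.Any using (here; there)
open import Data.List.Relation.Unary.All as All using (All)
open import Data.List.Relation.Unary.All.Properties using (++⁺; tabulate⁺)
open import Data.List.Membership.Propositional.Properties using (∈-∃++; ∈-++⁻)
open import Data.List.Extrema.Nat using (argmax; argmax-sel; f[⊥]≤f[argmax]; f[xs]≤f[argmax])
open import Data.Product using (_,_; ∃-syntax)
open import Data.Sum using (inj₁; inj₂)
open import Data.Empty using (⊥-elim)
open import Relation.Nullary using (does; yes; no)
open import Relation.Nullary.Decidable using (dec-true; dec-false)
open import Relation.Binary.PropositionalEquality as ≡ using (refl; trans; cong; cong₂; _≢_; module ≡-Reasoning)
open import Algebra.Properties.CommutativeSemigroup +-commutativeSemigroup
  using () renaming (interchange to +-interchange; x∙yz≈y∙xz to +-exchange)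
open import Algebra.Properties.Semiring.Sum +-*-semiring
  using (sum; sum-syntax; sum-cong-≗; ∑-distrib-+; sum-replicate-zero; *-distribˡ-sum; *-distribʳ-sum)

private
  variable
    n : ℕ

[_] : Bool → ℕ
[ true ] = 1
[ false ] = 0

[b]≤1 : ∀ b → [ b ] ≤ 1
[b]≤1 true = ≤-refl
[b]≤1 false = z≤n

[b]≡1⇒b≡true : ∀ {b} → [ b ] ≡ 1 → b ≡ true
[b]≡1⇒b≡true {true} _ = refl

[∧] : ∀ a b → [ a ∧ b ] ≡ [ a ] * [ b ]
[∧] true b = ≡.sym (+-identityʳ [ b ])
[∧] false b = refl

[b]+[not-b]≡1 : ∀ b → [ b ] + [ not b ] ≡ 1
[b]+[not-b]≡1 true = refl
[b]+[not-b]≡1 false = refl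

[b]*m≤m : ∀ b m → [ b ] * m ≤ m
[b]*m≤m true m = ≤-reflexive (+-identityʳ m)
[b]*m≤m false m = z≤n

[b]*[k*[b]]≡k*[b] : ∀ b k → [ b ] * (k * [ b ]) ≡ k * [ b ]
[b]*[k*[b]]≡k*[b] true k = +-identityʳ (k * 1)
[b]*[k*[b]]≡k*[b] false k = ≡.sym (*-zeroʳ k)

inclusion-exclusion : ∀ a b c → [ a ] * [ b ] + [ a ] * [ c ] ≤ [ a ] + [ a ] * ([ b ] * [ c ])
inclusion-exclusion true true true = ≤-refl
inclusion-exclusion true true false = ≤-refl
inclusion-exclusion true false true = ≤-refl
inclusion-exclusion true false false = z≤n
inclusion-exclusion false b c = z≤n

δ : Fin n → Fin n → ℕ
δ u v = [ does (u ≟ v) ]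

δ-refl : (v : Fin n) → δ v v ≡ 1
δ-refl v = cong [_] (dec-true (v ≟ v) refl)

δ-≢ : {u v : Fin n} → u ≢ v → δ u v ≡ 0
δ-≢ {u = u} {v} u≢v = cong [_] (dec-false (u ≟ v) u≢v)

δ-sym : (u v : Fin n) → δ u v ≡ δ v u
δ-sym u v with u ≟ v
... | yes refl = ≡.sym (δ-refl u)
... | no u≢v = ≡.sym (δ-≢ (λ v≡u → u≢v (≡.sym v≡u)))

∑-mono-≤ : {f g : Fin n → ℕ} → (∀ u → f u ≤ g u) → sum f ≤ sum g
∑-mono-≤ {zero} f≤g = z≤n
∑-mono-≤ {suc n} f≤g = +-mono-≤ (f≤g zero) (∑-mono-≤ (λ u → f≤g (suc u)))

∑-const : ∀ n k → ∑[ u < n ] k ≡ n * k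
∑-const zero k = refl
∑-const (suc n) k = cong (k +_) (∑-const n k)

∑-zero : {f : Fin n → ℕ} → (∀ u → f u ≡ 0) → sum f ≡ 0
∑-zero {n} f≡0 = trans (sum-cong-≗ f≡0) (sum-replicate-zero n)

∑-δ : (v : Fin n) (f : Fin n → ℕ) → ∑[ u < n ] (δ v u * f u) ≡ f v
∑-δ {suc n} zero f =
  trans (cong₂ _+_ (+-identityʳ (f zero)) (sum-replicate-zero n)) (+-identityʳ (f zero))
∑-δ {suc n} (suc v) f = ∑-δ v (λ u → f (suc u))

∑-δ-one : (v : Fin n) → ∑[ u < n ] δ v u ≡ 1
∑-δ-one {n} v = trans (sum-cong-≗ {n} (λ u → ≡.sym (*-identityʳ (δ v u)))) (∑-δ v (λ _ → 1))

f≤∑f : (f : Fin n → ℕ) (v : Fin n) → f v ≤ sum f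
f≤∑f f v = begin
  f v                      ≡⟨ ∑-δ v f ⟨
  ∑[ u < _ ] (δ v u * f u) ≤⟨ ∑-mono-≤ (λ u → [b]*m≤m (does (v ≟ u)) (f u)) ⟩
  sum f                    ∎
  where open ≤-Reasoning

∑-≤1 : (f : Fin n → ℕ) → (∀ u → f u ≤ 1) → (∀ u u' → u ≢ u' → f u * f u' ≡ 0) → sum f ≤ 1
∑-≤1 {zero} f f≤1 disjoint = z≤n
∑-≤1 {suc n} f f≤1 disjoint with f zero in f₀≡ | f≤1 zero
... | 0 | _ = ∑-≤1 (λ u → f (suc u)) (λ u → f≤1 (suc u))
                (λ u u' u≢u' → disjoint (suc u) (suc u') (λ eq → u≢u' (Finₚ.suc-injective eq)))
... | suc (suc _) | s≤s ()
... | 1 | _ = s≤s (≤-reflexive (∑-zero tail≡0))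
  where
  tail≡0 : ∀ u → f (suc u) ≡ 0
  tail≡0 u = trans (≡.sym (+-identityʳ (f (suc u))))
                   (≡.subst (λ x → x * f (suc u) ≡ 0) f₀≡ (disjoint zero (suc u) (λ ())))

∑-≤-tight : {f g : Fin n → ℕ} → (∀ u → f u ≤ g u) → sum g ≤ sum f → ∀ u → f u ≡ g u
∑-≤-tight {suc n} {f} {g} f≤g ∑g≤∑f zero =
  ≤-antisym (f≤g zero) (+-cancelʳ-≤ _ (g zero) (f zero)
    (≤-trans (+-monoʳ-≤ (g zero) (∑-mono-≤ (λ u → f≤g (suc u)))) ∑g≤∑f))
∑-≤-tight {suc n} {f} {g} f≤g ∑g≤∑f (suc u) =
  ∑-≤-tight (λ u → f≤g (suc u))
    (+-cancelˡ-≤ (f zero) _ _ (≤-trans (+-monoˡ-≤ _ (f≤g zero)) ∑g≤∑f)) u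

∑ₗ : {A : Set} → List A → (A → ℕ) → ℕ
∑ₗ xs f = sumˡ (map f xs)

infixl 10 ∑ₗ
syntax ∑ₗ xs (λ x → e) = ∑[ x ∈ xs ] e

module _ {A : Set} where

  ∑ₗ-++ : (xs ys : List A) (f : A → ℕ) → ∑ₗ (xs ++ ys) f ≡ ∑ₗ xs f + ∑ₗ ys f
  ∑ₗ-++ [] ys f = refl
  ∑ₗ-++ (x ∷ xs) ys f = trans (cong (f x +_) (∑ₗ-++ xs ys f)) (≡.sym (+-assoc (f x) _ _))

  ∑ₗ-cong : (xs : List A) {f g : A → ℕ} → (∀ x → f x ≡ g x) → ∑ₗ xs f ≡ ∑ₗ xs g
  ∑ₗ-cong [] f≡g = refl
  ∑ₗ-cong (x ∷ xs) f≡g = cong₂ _+_ (f≡g x) (∑ₗ-cong xs f≡g)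

  ∑ₗ-mono-≤ : (xs : List A) {f g : A → ℕ} → (∀ {x} → x ∈ xs → f x ≤ g x) → ∑ₗ xs f ≤ ∑ₗ xs g
  ∑ₗ-mono-≤ [] f≤g = z≤n
  ∑ₗ-mono-≤ (x ∷ xs) f≤g = +-mono-≤ (f≤g (here refl)) (∑ₗ-mono-≤ xs (λ x∈xs → f≤g (there x∈xs)))

  ∑ₗ-distrib-+ : (xs : List A) (f g : A → ℕ) → ∑[ x ∈ xs ] (f x + g x) ≡ ∑ₗ xs f + ∑ₗ xs g
  ∑ₗ-distrib-+ [] f g = refl
  ∑ₗ-distrib-+ (x ∷ xs) f g =
    trans (cong (f x + g x +_) (∑ₗ-distrib-+ xs f g)) (+-interchange (f x) (g x) _ _)

  *-distribˡ-∑ₗ : (xs : List A) (k : ℕ) (f : A → ℕ) → k * ∑ₗ xs f ≡ ∑[ x ∈ xs ] (k * f x)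
  *-distribˡ-∑ₗ [] k f = *-zeroʳ k
  *-distribˡ-∑ₗ (x ∷ xs) k f = trans (*-distribˡ-+ k (f x) _) (cong (k * f x +_) (*-distribˡ-∑ₗ xs k f))

  ∑ₗ-∑-comm : (xs : List A) (h : A → Fin n → ℕ) →
              ∑[ x ∈ xs ] ∑[ u < n ] h x u ≡ ∑[ u < n ] ∑[ x ∈ xs ] h x u
  ∑ₗ-∑-comm {n} [] h = ≡.sym (sum-replicate-zero n)
  ∑ₗ-∑-comm (x ∷ xs) h = trans (cong (sum (h x) +_) (∑ₗ-∑-comm xs h)) (≡.sym (∑-distrib-+ (h x) _))

  ∑ₗ≡0 : (xs : List A) (f : A → ℕ) → ∑ₗ xs f ≡ 0 → ∀ {x} → x ∈ xs → f x ≡ 0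
  ∑ₗ≡0 (y ∷ xs) f ∑≡0 (here refl) = m+n≡0⇒m≡0 (f y) ∑≡0
  ∑ₗ≡0 (y ∷ xs) f ∑≡0 (there x∈xs) = ∑ₗ≡0 xs f (m+n≡0⇒n≡0 (f y) ∑≡0) x∈xs

  ∑ₗ-zero : (xs : List A) {f : A → ℕ} → (∀ {x} → x ∈ xs → f x ≡ 0) → ∑ₗ xs f ≡ 0
  ∑ₗ-zero [] f≡0 = refl
  ∑ₗ-zero (x ∷ xs) f≡0 = cong₂ _+_ (f≡0 (here refl)) (∑ₗ-zero xs (λ x∈xs → f≡0 (there x∈xs)))

  ∑ₗ-tabulate : (g : Fin n → A) (f : A → ℕ) → ∑ₗ (tabulate g) f ≡ ∑[ u < n ] f (g u)
  ∑ₗ-tabulate {zero} g f = refl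
  ∑ₗ-tabulate {suc n} g f = cong (f (g zero) +_) (∑ₗ-tabulate (λ u → g (suc u)) f)

  length-filterᵇ : (p : A → Bool) (xs : List A) → length (filterᵇ p xs) ≡ ∑[ x ∈ xs ] [ p x ]
  length-filterᵇ p [] = refl
  length-filterᵇ p (x ∷ xs) with p x
  ... | true = cong suc (length-filterᵇ p xs)
  ... | false = length-filterᵇ p xs

-- Linear spaces

χ : Subset n → Fin n → ℕ
χ C u = [ lookup C u ]

_∉ₛ_ : Fin n → Subset n → Set
i ∉ₛ C = lookup C i ≡ false

∣C∣≡∑χ : (C : Subset n) → ∣ C ∣ ≡ sum (χ C)
∣C∣≡∑χ [] = refl
∣C∣≡∑χ (true ∷ C) = cong suc (∣C∣≡∑χ C)
∣C∣≡∑χ (false ∷ C) = ∣C∣≡∑χ C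

χ*χ≡χ : (C : Subset n) (v : Fin n) → χ C v * χ C v ≡ χ C v
χ*χ≡χ C v with lookup C v
... | true = refl
... | false = refl

meet : Subset n → Subset n → ℕ
meet L C = ∑[ u < _ ] (χ L u * χ C u)

pairCount : List (Subset n) → Fin n → Fin n → ℕ
pairCount 𝒞 i j = ∑[ L ∈ 𝒞 ] (χ L i * χ L j)

degree : List (Subset n) → Fin n → ℕ
degree 𝒞 v = ∑[ L ∈ 𝒞 ] χ L v

IsLinearSpace : List (Subset n) → Set
IsLinearSpace 𝒞 = ∀ i j → i ≢ j → pairCount 𝒞 i j ≡ 1

countContaining≡pairCount : (𝒞 : List (Subset n)) (i j : Fin n) → countContaining 𝒞 i j ≡ pairCount 𝒞 i j
countContaining≡pairCount 𝒞 i j =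
  trans (length-filterᵇ _ 𝒞) (∑ₗ-cong 𝒞 (λ L → [∧] (lookup L i) (lookup L j)))

pairCount-comm : (𝒞 : List (Subset n)) (i j : Fin n) → pairCount 𝒞 i j ≡ pairCount 𝒞 j i
pairCount-comm 𝒞 i j = ∑ₗ-cong 𝒞 (λ L → *-comm (χ L i) (χ L j))

pairCount-diag : (𝒞 : List (Subset n)) (v : Fin n) → pairCount 𝒞 v v ≡ degree 𝒞 v
pairCount-diag 𝒞 v = ∑ₗ-cong 𝒞 (λ L → χ*χ≡χ L v)

pairCount≤degree : (𝒞 : List (Subset n)) (v u : Fin n) → pairCount 𝒞 v u ≤ degree 𝒞 v
pairCount≤degree 𝒞 v u = ∑ₗ-mono-≤ 𝒞 (λ {L} _ → ≤-trans (≤-reflexive (*-comm (χ L v) (χ L u))) ([b]*m≤m (lookup L u) (χ L v)))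

weight≡∑degree : (𝒞 : List (Subset n)) → weight 𝒞 ≡ ∑[ v < n ] degree 𝒞 v
weight≡∑degree 𝒞 = trans (∑ₗ-cong 𝒞 ∣C∣≡∑χ) (∑ₗ-∑-comm 𝒞 χ)

double-counting : (𝒞 : List (Subset n)) (k : Fin n → ℕ) (X : Subset n → ℕ) →
  ∑[ u < n ] (k u * ∑[ L ∈ 𝒞 ] (χ L u * X L)) ≡ ∑[ L ∈ 𝒞 ] (X L * ∑[ u < n ] (χ L u * k u))
double-counting {n} 𝒞 k X = begin
  ∑[ u < n ] (k u * ∑[ L ∈ 𝒞 ] (χ L u * X L))  ≡⟨ sum-cong-≗ (λ u → *-distribˡ-∑ₗ 𝒞 (k u) _) ⟩
  ∑[ u < n ] ∑[ L ∈ 𝒞 ] (k u * (χ L u * X L))  ≡⟨ ∑ₗ-∑-comm 𝒞 (λ L u → k u * (χ L u * X L)) ⟨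
  ∑[ L ∈ 𝒞 ] ∑[ u < n ] (k u * (χ L u * X L))  ≡⟨ ∑ₗ-cong 𝒞 (λ L → sum-cong-≗ {n} (λ u → rearrange (k u) (χ L u) (X L))) ⟩
  ∑[ L ∈ 𝒞 ] ∑[ u < n ] (X L * (χ L u * k u))  ≡⟨ ∑ₗ-cong 𝒞 (λ L → *-distribˡ-sum {n} (X L) _) ⟨
  ∑[ L ∈ 𝒞 ] (X L * ∑[ u < n ] (χ L u * k u))  ∎
  where
  open ≡-Reasoning
  rearrange : ∀ a b c → a * (b * c) ≡ c * (b * a)
  rearrange = solve-∀

linearSpace-nonempty : {𝒞 : List (Subset n)} → IsLinearSpace 𝒞 → {i j : Fin n} → i ≢ j → 𝒞 ≢ []
linearSpace-nonempty linear i≢j refl with () ← linear _ _ i≢j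

maximum-block : (𝒞 : List (Subset n)) → 𝒞 ≢ [] → ∃[ C₀ ] (C₀ ∈ 𝒞 × All (λ L → ∣ L ∣ ≤ ∣ C₀ ∣) 𝒞)
maximum-block [] []≢[] = ⊥-elim ([]≢[] refl)
maximum-block (L ∷ 𝒞) _ =
  argmax ∣_∣ L 𝒞 , C₀∈L∷𝒞 , f[⊥]≤f[argmax] {f = ∣_∣} L 𝒞 All.∷ f[xs]≤f[argmax] {f = ∣_∣} L 𝒞
  where
  C₀∈L∷𝒞 : argmax ∣_∣ L 𝒞 ∈ L ∷ 𝒞
  C₀∈L∷𝒞 with argmax-sel ∣_∣ L 𝒞
  ... | inj₁ C₀≡L = here C₀≡L
  ... | inj₂ C₀∈𝒞 = there C₀∈𝒞

∑-pairCount : (𝒞 : List (Subset n)) → IsLinearSpace 𝒞 → (v : Fin n) →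
              ∑[ u < n ] pairCount 𝒞 v u + 1 ≡ degree 𝒞 v + n
∑-pairCount {n} 𝒞 linear v = begin
  ∑[ u < n ] pairCount 𝒞 v u + 1                   ≡⟨ cong (sum (pairCount 𝒞 v) +_) (∑-δ-one v) ⟨
  ∑[ u < n ] pairCount 𝒞 v u + ∑[ u < n ] δ v u    ≡⟨ ∑-distrib-+ (pairCount 𝒞 v) (δ v) ⟨
  ∑[ u < n ] (pairCount 𝒞 v u + δ v u)             ≡⟨ sum-cong-≗ pointwise ⟩
  ∑[ u < n ] (δ v u * degree 𝒞 v + 1)              ≡⟨ ∑-distrib-+ (λ u → δ v u * degree 𝒞 v) (λ _ → 1) ⟩
  ∑[ u < n ] (δ v u * degree 𝒞 v) + ∑[ u < n ] 1   ≡⟨ cong₂ _+_ (∑-δ v (λ _ → degree 𝒞 v)) (trans (∑-const n 1) (*-identityʳ n)) ⟩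
  degree 𝒞 v + n                                   ∎
  where
  open ≡-Reasoning
  pointwise : ∀ u → pairCount 𝒞 v u + δ v u ≡ δ v u * degree 𝒞 v + 1
  pointwise u with v ≟ u
  ... | yes refl = cong (_+ 1) (trans (pairCount-diag 𝒞 v) (≡.sym (+-identityʳ _)))
  ... | no v≢u = trans (+-identityʳ _) (linear v u v≢u)

-- Each of the n − 1 other points is joined to v by exactly one block through v, and each such
-- block contains at most m − 1 of them; this is (n − 1) ≤ (m − 1) · degree 𝒞 v without subtraction.
degree-bound : (𝒞 : List (Subset n)) → IsLinearSpace 𝒞 → (m : ℕ) → All (λ L → ∣ L ∣ ≤ m) 𝒞 →
               (v : Fin n) → degree 𝒞 v + n ≤ m * degree 𝒞 v + 1
degree-bound {n} 𝒞 linear m bounded v = begin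
  degree 𝒞 v + n                                 ≡⟨ ∑-pairCount 𝒞 linear v ⟨
  ∑[ u < n ] pairCount 𝒞 v u + 1                 ≤⟨ +-monoˡ-≤ 1 ∑-pairCount≤ ⟩
  m * degree 𝒞 v + 1                             ∎
  where
  open ≤-Reasoning
  ∑-pairCount≤ : ∑[ u < n ] pairCount 𝒞 v u ≤ m * degree 𝒞 v
  ∑-pairCount≤ = begin
    ∑[ u < n ] pairCount 𝒞 v u
      ≡⟨ sum-cong-≗ (λ u → trans (pairCount-comm 𝒞 v u) (≡.sym (*-identityˡ _))) ⟩
    ∑[ u < n ] (1 * ∑[ L ∈ 𝒞 ] (χ L u * χ L v))
      ≡⟨ double-counting 𝒞 (λ _ → 1) (λ L → χ L v) ⟩
    ∑[ L ∈ 𝒞 ] (χ L v * ∑[ u < n ] (χ L u * 1))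
      ≤⟨ ∑ₗ-mono-≤ 𝒞 (λ {L} L∈𝒞 → *-monoʳ-≤ (χ L v) (size≤m L∈𝒞)) ⟩
    ∑[ L ∈ 𝒞 ] (χ L v * m)
      ≡⟨ ∑ₗ-cong 𝒞 (λ L → *-comm (χ L v) m) ⟩
    ∑[ L ∈ 𝒞 ] (m * χ L v)
      ≡⟨ *-distribˡ-∑ₗ 𝒞 m (λ L → χ L v) ⟨
    m * degree 𝒞 v ∎
    where
    size≤m : ∀ {L} → L ∈ 𝒞 → ∑[ u < n ] (χ L u * 1) ≤ m
    size≤m {L} L∈𝒞 = begin
      ∑[ u < n ] (χ L u * 1) ≡⟨ sum-cong-≗ (λ u → *-identityʳ (χ L u)) ⟩
      sum (χ L)              ≡⟨ ∣C∣≡∑χ L ⟨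
      ∣ L ∣                  ≤⟨ All.lookup bounded L∈𝒞 ⟩
      m                      ∎

module MaximumBlock (xs zs : List (Subset n)) (C₀ : Subset n)
  (linear : IsLinearSpace (xs ++ C₀ ∷ zs))
  (maximal : All (λ L → ∣ L ∣ ≤ ∣ C₀ ∣) (xs ++ C₀ ∷ zs))
  (w : Fin n) (w∉C₀ : w ∉ₛ C₀) where

  𝒞 R : List (Subset n)
  𝒞 = xs ++ C₀ ∷ zs
  R = xs ++ zs

  m : ℕ
  m = ∣ C₀ ∣

  ∑ₗ-𝒞 : (f : Subset n → ℕ) → ∑ₗ 𝒞 f ≡ f C₀ + ∑ₗ R f
  ∑ₗ-𝒞 f = begin
    ∑ₗ 𝒞 f                       ≡⟨ ∑ₗ-++ xs (C₀ ∷ zs) f ⟩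
    ∑ₗ xs f + (f C₀ + ∑ₗ zs f)   ≡⟨ +-exchange (∑ₗ xs f) (f C₀) (∑ₗ zs f) ⟩
    f C₀ + (∑ₗ xs f + ∑ₗ zs f)   ≡⟨ cong (f C₀ +_) (∑ₗ-++ xs zs f) ⟨
    f C₀ + ∑ₗ R f                ∎
    where open ≡-Reasoning

  inside-outside : ∀ {u v} → u ∈ₛ C₀ → v ∉ₛ C₀ → pairCount R u v ≡ 1
  inside-outside {u} {v} u∈ v∉ =
    ≡.subst₂ (λ a b → [ a ] * [ b ] + pairCount R u v ≡ 1) u∈ v∉
      (trans (≡.sym (∑ₗ-𝒞 _)) (linear u v u≢v))
    where
    u≢v : u ≢ v
    u≢v refl with () ← trans (≡.sym u∈) v∉

  inside-inside : ∀ {u u'} → u ∈ₛ C₀ → u' ∈ₛ C₀ → u ≢ u' → pairCount R u u' ≡ 0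
  inside-inside {u} {u'} u∈ u'∈ u≢u' = suc-injective
    (≡.subst₂ (λ a b → [ a ] * [ b ] + pairCount R u u' ≡ 1) u∈ u'∈
      (trans (≡.sym (∑ₗ-𝒞 _)) (linear u u' u≢u')))

  meet-≤1 : ∀ {L} → L ∈ R → meet L C₀ ≤ 1
  meet-≤1 {L} L∈R = ∑-≤1 (λ u → χ L u * χ C₀ u) (λ u → *-mono-≤ ([b]≤1 (lookup L u)) ([b]≤1 (lookup C₀ u))) disjoint
    where
    disjoint : ∀ u u' → u ≢ u' → χ L u * χ C₀ u * (χ L u' * χ C₀ u') ≡ 0
    disjoint u u' u≢u' with lookup C₀ u in u∈ | lookup C₀ u' in u'∈
    ... | false | b = cong (_* (χ L u' * [ b ])) (*-zeroʳ (χ L u))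
    ... | true | false = trans (cong (χ L u * 1 *_) (*-zeroʳ (χ L u'))) (*-zeroʳ (χ L u * 1))
    ... | true | true = trans (cong₂ _*_ (*-identityʳ (χ L u)) (*-identityʳ (χ L u')))
                              (∑ₗ≡0 R (λ L → χ L u * χ L u') (inside-inside u∈ u'∈ u≢u') L∈R)

  degree-outside : ∀ {v} → v ∉ₛ C₀ → m ≤ degree 𝒞 v
  degree-outside {v} v∉ = begin
    m                                             ≡⟨ ∣C∣≡∑χ C₀ ⟩
    sum (χ C₀)                                    ≡⟨ sum-cong-≗ counted-once ⟩
    ∑[ u < n ] (χ C₀ u * pairCount R u v)         ≡⟨ double-counting R (χ C₀) (λ L → χ L v) ⟩
    ∑[ L ∈ R ] (χ L v * meet L C₀)                ≤⟨ ∑ₗ-mono-≤ R (λ {L} L∈R → *-monoʳ-≤ (χ L v) (meet-≤1 L∈R)) ⟩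
    ∑[ L ∈ R ] (χ L v * 1)                        ≡⟨ ∑ₗ-cong R (λ L → *-identityʳ (χ L v)) ⟩
    degree R v                                    ≤⟨ m≤n+m _ (χ C₀ v) ⟩
    χ C₀ v + degree R v                           ≡⟨ ∑ₗ-𝒞 (λ L → χ L v) ⟨
    degree 𝒞 v                                    ∎
    where
    open ≤-Reasoning
    counted-once : ∀ u → χ C₀ u ≡ χ C₀ u * pairCount R u v
    counted-once u with lookup C₀ u in u∈
    ... | false = refl
    ... | true = ≡.sym (trans (+-identityʳ _) (inside-outside u∈ v∉))

  degree-inside : ∀ {v} → v ∈ₛ C₀ → degree 𝒞 v ≡ suc (degree R v)
  degree-inside {v} v∈ = ≡.subst (λ b → degree 𝒞 v ≡ [ b ] + degree R v) v∈ (∑ₗ-𝒞 (λ L → χ L v))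

  two≤degree-inside : ∀ {v} → v ∈ₛ C₀ → 2 ≤ degree 𝒞 v
  two≤degree-inside {v} v∈ = begin
    2                        ≡⟨ cong suc (inside-outside v∈ w∉C₀) ⟨
    suc (pairCount R v w)    ≤⟨ s≤s (pairCount≤degree R v w) ⟩
    suc (degree R v)         ≡⟨ degree-inside v∈ ⟨
    degree 𝒞 v               ∎
    where open ≤-Reasoning

  -- through v counts the blocks other than C₀ through v, d and e: at most the one block through
  -- d and e, which meets C₀ at most once.
  module Triangle {d e : Fin n} (d∉ : d ∉ₛ C₀) (e∉ : e ∉ₛ C₀) (d≢e : d ≢ e) where

    through : Fin n → ℕ
    through v = ∑[ L ∈ R ] (χ L v * (χ L d * χ L e))

    three≤degree+through : ∀ {v} → v ∈ₛ C₀ → 3 ≤ degree 𝒞 v + through v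
    three≤degree+through {v} v∈ = begin
      3                                                    ≡⟨ cong suc pairs-from-v ⟨
      suc (pairCount R v d + pairCount R v e)              ≡⟨ cong suc (∑ₗ-distrib-+ R _ _) ⟨
      suc (∑[ L ∈ R ] (χ L v * χ L d + χ L v * χ L e))     ≤⟨ s≤s (∑ₗ-mono-≤ R (λ {L} _ → inclusion-exclusion
                                                                 (lookup L v) (lookup L d) (lookup L e))) ⟩
      suc (∑[ L ∈ R ] (χ L v + χ L v * (χ L d * χ L e)))   ≡⟨ cong suc (∑ₗ-distrib-+ R _ _) ⟩
      suc (degree R v + through v)                         ≡⟨ cong (_+ through v) (degree-inside v∈) ⟨
      degree 𝒞 v + through v                               ∎
      where
      open ≤-Reasoning
      pairs-from-v : pairCount R v d + pairCount R v e ≡ 2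
      pairs-from-v = cong₂ _+_ (inside-outside v∈ d∉) (inside-outside v∈ e∉)

    ∑-through-inside≤1 : ∑[ v < n ] (χ C₀ v * through v) ≤ 1
    ∑-through-inside≤1 = begin
      ∑[ v < n ] (χ C₀ v * through v)            ≡⟨ double-counting R (χ C₀) (λ L → χ L d * χ L e) ⟩
      ∑[ L ∈ R ] (χ L d * χ L e * meet L C₀)     ≤⟨ ∑ₗ-mono-≤ R (λ {L} L∈R → *-monoʳ-≤ (χ L d * χ L e) (meet-≤1 L∈R)) ⟩
      ∑[ L ∈ R ] (χ L d * χ L e * 1)             ≡⟨ ∑ₗ-cong R (λ L → *-identityʳ (χ L d * χ L e)) ⟩
      pairCount R d e                            ≤⟨ m≤n+m _ (χ C₀ d * χ C₀ e) ⟩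
      χ C₀ d * χ C₀ e + pairCount R d e          ≡⟨ ∑ₗ-𝒞 (λ L → χ L d * χ L e) ⟨
      pairCount 𝒞 d e                            ≡⟨ linear d e d≢e ⟩
      1                                          ∎
      where open ≤-Reasoning

  χ̅ : Fin n → ℕ
  χ̅ u = [ not (lookup C₀ u) ]

  outside : ℕ
  outside = sum χ̅

  totalDegree : ℕ
  totalDegree = ∑[ v < n ] degree 𝒞 v

  ∑-by-membership : ∀ a b → ∑[ v < n ] (χ C₀ v * a + χ̅ v * b) ≡ m * a + outside * b
  ∑-by-membership a b = begin
    ∑[ v < n ] (χ C₀ v * a + χ̅ v * b)               ≡⟨ ∑-distrib-+ (λ v → χ C₀ v * a) (λ v → χ̅ v * b) ⟩
    ∑[ v < n ] (χ C₀ v * a) + ∑[ v < n ] (χ̅ v * b)  ≡⟨ cong₂ _+_ (*-distribʳ-sum a (χ C₀)) (*-distribʳ-sum b χ̅) ⟨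
    sum (χ C₀) * a + outside * b                     ≡⟨ cong (λ k → k * a + outside * b) (∣C∣≡∑χ C₀) ⟨
    m * a + outside * b                              ∎
    where open ≡-Reasoning

  n≡m+outside : n ≡ m + outside
  n≡m+outside = begin
    n                                   ≡⟨ *-identityʳ n ⟨
    n * 1                               ≡⟨ ∑-const n 1 ⟨
    ∑[ v < n ] 1                        ≡⟨ sum-cong-≗ in-or-out ⟩
    ∑[ v < n ] (χ C₀ v * 1 + χ̅ v * 1)   ≡⟨ ∑-by-membership 1 1 ⟩
    m * 1 + outside * 1                 ≡⟨ cong₂ _+_ (*-identityʳ m) (*-identityʳ outside) ⟩
    m + outside                         ∎
    where
    open ≡-Reasoning
    in-or-out : ∀ v → 1 ≡ χ C₀ v * 1 + χ̅ v * 1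
    in-or-out v with lookup C₀ v
    ... | true = refl
    ... | false = refl

  1≤outside : 1 ≤ outside
  1≤outside = ≤-trans (≤-reflexive (cong (λ b → [ not b ]) (≡.sym w∉C₀))) (f≤∑f χ̅ w)

  another-outside-point : 2 ≤ outside → ∃[ e ] (e ∉ₛ C₀ × e ≢ w)
  another-outside-point 2≤outside = witness (¬∀⟶∃¬ n _ (λ u → χ̅ u ≤? δ w u) only-w)
    where
    only-w : ¬ (∀ u → χ̅ u ≤ δ w u)
    only-w χ̅≤δ = <⇒≱ 2≤outside (≤-trans (∑-mono-≤ χ̅≤δ) (≤-reflexive (∑-δ-one w)))
    witness : (∃[ e ] ¬ χ̅ e ≤ δ w e) → ∃[ e ] (e ∉ₛ C₀ × e ≢ w)
    witness (e , χ̅≰δ) with lookup C₀ e in e∈? | w ≟ e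
    ... | true | _ = ⊥-elim (χ̅≰δ z≤n)
    ... | false | yes refl = ⊥-elim (χ̅≰δ ≤-refl)
    ... | false | no w≢e = e , e∈? , λ e≡w → w≢e (≡.sym e≡w)

  bound-one-outside : outside ≡ 1 → 3 * n ≤ totalDegree + 3
  bound-one-outside outside≡1 = begin
    3 * n                                  ≡⟨ cong (3 *_) n≡m+outside ⟩
    3 * (m + outside)                      ≡⟨ cong (λ k → 3 * (m + k)) outside≡1 ⟩
    3 * (m + 1)                            ≡⟨ rearrange m ⟩
    m * 2 + 1 * m + 3                      ≡⟨ cong (λ k → m * 2 + k * m + 3) outside≡1 ⟨
    m * 2 + outside * m + 3                ≡⟨ cong (_+ 3) (∑-by-membership 2 m) ⟨
    ∑[ v < n ] (χ C₀ v * 2 + χ̅ v * m) + 3  ≤⟨ +-monoˡ-≤ 3 (∑-mono-≤ pointwise) ⟩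
    totalDegree + 3                        ∎
    where
    open ≤-Reasoning
    rearrange : ∀ a → 3 * (a + 1) ≡ a * 2 + 1 * a + 3
    rearrange = solve-∀
    pointwise : ∀ v → χ C₀ v * 2 + χ̅ v * m ≤ degree 𝒞 v
    pointwise v with lookup C₀ v in v∈?
    ... | true = two≤degree-inside v∈?
    ... | false = ≤-trans (≤-reflexive (+-identityʳ m)) (degree-outside v∈?)

  bound-large-block : 2 ≤ outside → 3 ≤ m → 3 * n ≤ totalDegree + 1
  bound-large-block 2≤outside 3≤m with another-outside-point 2≤outside
  ... | e , e∉ , e≢w = begin
    3 * n                                                   ≡⟨ cong (3 *_) n≡m+outside ⟩
    3 * (m + outside)                                       ≡⟨ rearrange m outside ⟩
    m * 3 + outside * 3                                     ≤⟨ +-monoʳ-≤ (m * 3) (*-monoʳ-≤ outside 3≤m) ⟩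
    m * 3 + outside * m                                     ≡⟨ ∑-by-membership 3 m ⟨
    ∑[ v < n ] (χ C₀ v * 3 + χ̅ v * m)                       ≤⟨ ∑-mono-≤ pointwise ⟩
    ∑[ v < n ] (degree 𝒞 v + χ C₀ v * through v)            ≡⟨ ∑-distrib-+ (degree 𝒞) (λ v → χ C₀ v * through v) ⟩
    totalDegree + ∑[ v < n ] (χ C₀ v * through v)           ≤⟨ +-monoʳ-≤ totalDegree ∑-through-inside≤1 ⟩
    totalDegree + 1                                         ∎
    where
    open ≤-Reasoning
    open Triangle w∉C₀ e∉ (λ w≡e → e≢w (≡.sym w≡e))
    rearrange : ∀ a b → 3 * (a + b) ≡ a * 3 + b * 3
    rearrange = solve-∀
    pointwise : ∀ v → χ C₀ v * 3 + χ̅ v * m ≤ degree 𝒞 v + χ C₀ v * through v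
    pointwise v with lookup C₀ v in v∈?
    ... | true = ≤-trans (three≤degree+through v∈?) (≤-reflexive (cong (degree 𝒞 v +_) (≡.sym (+-identityʳ _))))
    ... | false = +-monoˡ-≤ 0 (degree-outside v∈?)

  bound-small-blocks : 2 ≤ outside → m ≤ 2 → 3 * n ≤ totalDegree
  bound-small-blocks 2≤outside m≤2 = begin
    3 * n            ≡⟨ *-comm 3 n ⟩
    n * 3            ≡⟨ ∑-const n 3 ⟨
    ∑[ v < n ] 3     ≤⟨ ∑-mono-≤ three≤degree ⟩
    totalDegree      ∎
    where
    open ≤-Reasoning
    n≤degree+1 : ∀ v → n ≤ degree 𝒞 v + 1
    n≤degree+1 v = +-cancelˡ-≤ (degree 𝒞 v) n (degree 𝒞 v + 1) (begin
      degree 𝒞 v + n          ≤⟨ degree-bound 𝒞 linear m maximal v ⟩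
      m * degree 𝒞 v + 1      ≤⟨ +-monoˡ-≤ 1 (*-monoˡ-≤ (degree 𝒞 v) m≤2) ⟩
      2 * degree 𝒞 v + 1      ≡⟨ +-assoc (degree 𝒞 v) (degree 𝒞 v + 0) 1 ⟩
      degree 𝒞 v + (degree 𝒞 v + 0 + 1) ≡⟨ cong (λ k → degree 𝒞 v + (k + 1)) (+-identityʳ _) ⟩
      degree 𝒞 v + (degree 𝒞 v + 1) ∎)
    2≤m : 2 ≤ m
    2≤m with m ≤? 1
    ... | no m≰1 = ≰⇒> m≰1
    ... | yes m≤1 = ⊥-elim (<⇒≱ 2≤n (+-cancelˡ-≤ (degree 𝒞 w) n 1
            (≤-trans (degree-bound 𝒞 linear m maximal w)
                     (+-monoˡ-≤ 1 (≤-trans (*-monoˡ-≤ (degree 𝒞 w) m≤1) (≤-reflexive (+-identityʳ _)))))))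
      where
      2≤n : 2 ≤ n
      2≤n = ≤-trans 2≤outside (≤-trans (m≤n+m outside m) (≤-reflexive (≡.sym n≡m+outside)))
    three≤degree : ∀ v → 3 ≤ degree 𝒞 v
    three≤degree v = +-cancelʳ-≤ 1 3 (degree 𝒞 v) (≤-trans 4≤n (n≤degree+1 v))
      where
      4≤n : 4 ≤ n
      4≤n = ≤-trans (+-mono-≤ 2≤m 2≤outside) (≤-reflexive (≡.sym n≡m+outside))

  bound : 3 * n ≤ totalDegree + 3 × (3 * n ≤ totalDegree + 1 ⊎ suc m ≡ n)
  bound with outside ≟ℕ 1
  ... | yes outside≡1 =
    bound-one-outside outside≡1 ,
    inj₂ (trans (+-comm 1 m) (trans (cong (m +_) (≡.sym outside≡1)) (≡.sym n≡m+outside)))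
  ... | no outside≢1 = ≤-trans 3n≤totalDegree+1 (+-monoʳ-≤ totalDegree (s≤s z≤n)) , inj₁ 3n≤totalDegree+1
    where
    2≤outside : 2 ≤ outside
    2≤outside = ≤∧≢⇒< 1≤outside (λ 1≡outside → outside≢1 (≡.sym 1≡outside))
    3n≤totalDegree+1 : 3 * n ≤ totalDegree + 1
    3n≤totalDegree+1 with m ≤? 2
    ... | yes m≤2 = ≤-trans (bound-small-blocks 2≤outside m≤2) (m≤m+n totalDegree 1)
    ... | no m≰2 = bound-large-block 2≤outside (≰⇒> m≰2)

linearSpace-weight-bound : (𝒞 : List (Subset n)) → IsLinearSpace 𝒞 →
  {C₀ : Subset n} → C₀ ∈ 𝒞 → All (λ L → ∣ L ∣ ≤ ∣ C₀ ∣) 𝒞 → {w : Fin n} → w ∉ₛ C₀ →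
  3 * n ≤ weight 𝒞 + 3 × (3 * n ≤ weight 𝒞 + 1 ⊎ suc ∣ C₀ ∣ ≡ n)
linearSpace-weight-bound 𝒞 linear {C₀} C₀∈𝒞 maximal w∉C₀ with ∈-∃++ C₀∈𝒞
... | xs , zs , refl rewrite weight≡∑degree (xs ++ C₀ ∷ zs) =
  MaximumBlock.bound xs zs C₀ linear maximal _ w∉C₀

-- Clique partitions of a graph and of its complement

edge⇒≢ : (G : Graph n) {i j : Fin n} → Edge G i j → i ≢ j
edge⇒≢ G {i} ij refl with () ← trans (≡.sym ij) (irrefl G i)

adj-complement : (G : Graph n) {i j : Fin n} → i ≢ j → {b : Bool} → adj G i j ≡ b → adj (complement G) i j ≡ not b
adj-complement G {i} {j} i≢j refl = cong (λ b → if b then false else not (adj G i j)) (dec-false (i ≟ j) i≢j)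

complement-involutive : (G : Graph n) (i j : Fin n) → adj (complement (complement G)) i j ≡ adj G i j
complement-involutive G i j with i ≟ j
... | yes refl = ≡.sym (irrefl G i)
... | no _ = not-involutive (adj G i j)

IsCliquePartition-cong : {H H′ : Graph n} → (∀ i j → adj H i j ≡ adj H′ i j) →
                         {𝒞 : List (Subset n)} → IsCliquePartition H 𝒞 → IsCliquePartition H′ 𝒞
IsCliquePartition-cong H≡H′ 𝒞-part = record
  { allCliques = All.map (λ clique i j i∈ j∈ i≢j → trans (≡.sym (H≡H′ i j)) (clique i j i∈ j∈ i≢j)) allCliques
  ; exactlyOne = λ i j ij → exactlyOne i j (trans (H≡H′ i j) ij)
  }
  where open IsCliquePartition 𝒞-part

nonEdge-pairCount : (K : Graph n) {𝒞 : List (Subset n)} → All (IsClique K) 𝒞 →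
                    {i j : Fin n} → adj K i j ≡ false → i ≢ j → pairCount 𝒞 i j ≡ 0
nonEdge-pairCount K {𝒞} cliques {i} {j} ij∉ i≢j = ∑ₗ-zero 𝒞 (λ {L} L∈𝒞 → not-both-in {L} (All.lookup cliques L∈𝒞))
  where
  not-both-in : ∀ {L} → IsClique K L → χ L i * χ L j ≡ 0
  not-both-in {L} L-clique with lookup L i in i∈? | lookup L j in j∈?
  ... | false | _ = refl
  ... | true | false = refl
  ... | true | true with () ← trans (≡.sym (L-clique i j i∈? j∈? i≢j)) ij∉

partition-covers : {H : Graph n} {𝒞 : List (Subset n)} → IsCliquePartition H 𝒞 →
                   {i j : Fin n} → Edge H i j → pairCount 𝒞 i j ≡ 1
partition-covers {𝒞 = 𝒞} 𝒞-part {i} {j} ij =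
  trans (≡.sym (countContaining≡pairCount 𝒞 i j)) (IsCliquePartition.exactlyOne 𝒞-part i j ij)

partition-avoids : {H : Graph n} {𝒞 : List (Subset n)} → IsCliquePartition H 𝒞 →
                   {i j : Fin n} → adj H i j ≡ false → i ≢ j → pairCount 𝒞 i j ≡ 0
partition-avoids {H = H} 𝒞-part = nonEdge-pairCount H (IsCliquePartition.allCliques 𝒞-part)

partitions-linearSpace : (G : Graph n) {P Q : List (Subset n)} →
  IsCliquePartition G P → IsCliquePartition (complement G) Q → IsLinearSpace (P ++ Q)
partitions-linearSpace G {P} {Q} P-part Q-part i j i≢j with adj G i j in ij∈G?
... | true  = trans (∑ₗ-++ P Q _) (cong₂ _+_ (partition-covers P-part ij∈G?)
                                            (partition-avoids Q-part (adj-complement G i≢j ij∈G?) i≢j))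
... | false = trans (∑ₗ-++ P Q _) (cong₂ _+_ (partition-avoids P-part ij∈G? i≢j)
                                            (partition-covers Q-part (adj-complement G i≢j ij∈G?)))

partitions-block-clique : (G : Graph n) {P Q : List (Subset n)} →
  IsCliquePartition G P → IsCliquePartition (complement G) Q →
  ∀ {C} → C ∈ P ++ Q → IsClique G C ⊎ IsClique (complement G) C
partitions-block-clique G {P} P-part Q-part C∈P++Q with ∈-++⁻ P C∈P++Q
... | inj₁ C∈P = inj₁ (All.lookup (IsCliquePartition.allCliques P-part) C∈P)
... | inj₂ C∈Q = inj₂ (All.lookup (IsCliquePartition.allCliques Q-part) C∈Q)

edge-exists : (G : Graph n) → ¬ IsEmptyGraph G → ∃[ i ] ∃[ j ] Edge G i j
edge-exists {n} G nonEmpty =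
  let i , i-not-isolated = ¬∀⟶∃¬ n _ (λ i → all? (λ j → adj G i j Boolₚ.≟ false)) nonEmpty
      j , ij≢false = ¬∀⟶∃¬ n _ (λ j → adj G i j Boolₚ.≟ false) i-not-isolated
  in i , j , ¬-not ij≢false

clique-misses-vertex : (G : Graph n) → ¬ IsEmptyGraph G → ¬ IsCompleteGraph G →
                       {C : Subset n} → IsClique G C ⊎ IsClique (complement G) C → ∃[ w ] w ∉ₛ C
clique-misses-vertex {n} G nonEmpty nonComplete {C} clique =
  let w , w∉C = ¬∀⟶∃¬ n (_∈ₛ C) (λ u → lookup C u Boolₚ.≟ true) (not-full clique) in w , ¬-not w∉C
  where
  not-full : IsClique G C ⊎ IsClique (complement G) C → ¬ (∀ u → u ∈ₛ C)
  not-full (inj₁ C-clique) full = nonComplete (λ i j → C-clique i j (full i) (full j))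
  not-full (inj₂ C-coclique) full = nonEmpty no-edge
    where
    no-edge : IsEmptyGraph G
    no-edge i j with i ≟ j
    ... | yes refl = irrefl G i
    ... | no i≢j with adj G i j in ij∈G?
    ...   | false = refl
    ...   | true with () ← trans (≡.sym (C-coclique i j (full i) (full j) i≢j)) (adj-complement G i≢j ij∈G?)

maximum-block-misses-vertex : (G : Graph n) → ¬ IsEmptyGraph G → ¬ IsCompleteGraph G →
  {P Q : List (Subset n)} → IsCliquePartition G P → IsCliquePartition (complement G) Q →
  ∃[ C₀ ] (C₀ ∈ P ++ Q × All (λ L → ∣ L ∣ ≤ ∣ C₀ ∣) (P ++ Q) × ∃[ w ] w ∉ₛ C₀)
maximum-block-misses-vertex G nonEmpty nonComplete {P} {Q} P-part Q-part =
  let i , j , ij = edge-exists G nonEmpty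
      C₀ , C₀∈P++Q , maximal =
        maximum-block (P ++ Q) (linearSpace-nonempty (partitions-linearSpace G P-part Q-part) (edge⇒≢ G ij))
  in C₀ , C₀∈P++Q , maximal ,
     clique-misses-vertex G nonEmpty nonComplete {C₀} (partitions-block-clique G P-part Q-part C₀∈P++Q)

3[1+n]≡3n+3 : ∀ n → 3 * suc n ≡ 3 * n + 3
3[1+n]≡3n+3 = solve-∀

+3≤+1⇒< : ∀ {k W} → k + 3 ≤ W + 1 → k < W
+3≤+1⇒< {k} {W} k+3≤W+1 =
  +-cancelʳ-≤ 1 (suc k) W (≤-trans (≤-reflexive (≡.sym (+-suc k 1))) (≤-trans (+-monoʳ-≤ k (n≤1+n 2)) k+3≤W+1))

partitions-weight-bound : (G : Graph (suc n)) → ¬ IsEmptyGraph G → ¬ IsCompleteGraph G →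
  {P Q : List (Subset (suc n))} → IsCliquePartition G P → IsCliquePartition (complement G) Q →
  3 * n ≤ weight P + weight Q ×
  (3 * n < weight P + weight Q ⊎ HasCliqueOfSize G n ⊎ HasCliqueOfSize (complement G) n)
partitions-weight-bound {n} G nonEmpty nonComplete {P} {Q} P-part Q-part =
  let C₀ , C₀∈P++Q , maximal , w , w∉C₀ = maximum-block-misses-vertex G nonEmpty nonComplete P-part Q-part
      lower , strict-or-spanning =
        linearSpace-weight-bound (P ++ Q) (partitions-linearSpace G P-part Q-part) C₀∈P++Q maximal w∉C₀
  in +-cancelʳ-≤ 3 (3 * n) W (shift lower) , strict-or-clique C₀∈P++Q strict-or-spanning
  where
  W : ℕ
  W = weight P + weight Q
  shift : ∀ {k} → 3 * suc n ≤ weight (P ++ Q) + k → 3 * n + 3 ≤ W + k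
  shift {k} = ≡.subst₂ (λ a b → a ≤ b + k) (3[1+n]≡3n+3 n) (∑ₗ-++ P Q ∣_∣)
  strict-or-clique : ∀ {C₀} → C₀ ∈ P ++ Q → 3 * suc n ≤ weight (P ++ Q) + 1 ⊎ suc ∣ C₀ ∣ ≡ suc n →
                     3 * n < W ⊎ HasCliqueOfSize G n ⊎ HasCliqueOfSize (complement G) n
  strict-or-clique _ (inj₁ 3n+3≤W+1) = inj₁ (+3≤+1⇒< (shift 3n+3≤W+1))
  strict-or-clique {C₀} C₀∈P++Q (inj₂ 1+∣C₀∣≡1+n) with partitions-block-clique G P-part Q-part C₀∈P++Q
  ... | inj₁ C₀-clique = inj₂ (inj₁ (C₀ , C₀-clique , suc-injective 1+∣C₀∣≡1+n))
  ... | inj₂ C₀-coclique = inj₂ (inj₂ (C₀ , C₀-coclique , suc-injective 1+∣C₀∣≡1+n))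

-- Partitions of total weight 3(n − 1)

deg : Graph n → Fin n → ℕ
deg G v = ∑[ u < _ ] [ adj G v u ]

deg+deg-complement : (K : Graph (suc n)) (v : Fin (suc n)) → deg K v + deg (complement K) v ≡ n
deg+deg-complement {n} K v = suc-injective (begin
  suc (deg K v + deg Kᶜ v)                                    ≡⟨ +-comm 1 _ ⟩
  deg K v + deg Kᶜ v + 1                                      ≡⟨ cong (deg K v + deg Kᶜ v +_) (∑-δ-one v) ⟨
  deg K v + deg Kᶜ v + ∑[ u < suc n ] δ v u                   ≡⟨ cong (_+ sum (δ v)) (∑-distrib-+ (λ u → [ adj K v u ]) (λ u → [ adj Kᶜ v u ])) ⟨
  ∑[ u < suc n ] ([ adj K v u ] + [ adj Kᶜ v u ]) + sum (δ v) ≡⟨ ∑-distrib-+ (λ u → [ adj K v u ] + [ adj Kᶜ v u ]) (δ v) ⟨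
  ∑[ u < suc n ] ([ adj K v u ] + [ adj Kᶜ v u ] + δ v u)     ≡⟨ sum-cong-≗ pointwise ⟩
  ∑[ u < suc n ] 1                                            ≡⟨ trans (∑-const (suc n) 1) (*-identityʳ (suc n)) ⟩
  suc n                                                       ∎)
  where
  open ≡-Reasoning
  Kᶜ = complement K
  pointwise : ∀ u → [ adj K v u ] + [ adj Kᶜ v u ] + δ v u ≡ 1
  pointwise u with v ≟ u
  ... | yes refl rewrite irrefl K v = refl
  ... | no _ = trans (+-identityʳ _) ([b]+[not-b]≡1 (adj K v u))

complement-of-point : (C : Subset (suc n)) → ∣ C ∣ ≡ n → ∃[ v ] (v ∉ₛ C × ∀ u → u ≢ v → u ∈ₛ C)
complement-of-point {n} C ∣C∣≡n =
  let v , v∉C = ¬∀⟶∃¬ (suc n) (_∈ₛ C) (λ u → lookup C u Boolₚ.≟ true) not-full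
  in v , ¬-not v∉C , others-in (¬-not v∉C)
  where
  ∑χC≡n : sum (χ C) ≡ n
  ∑χC≡n = trans (≡.sym (∣C∣≡∑χ C)) ∣C∣≡n
  not-full : ¬ (∀ u → u ∈ₛ C)
  not-full full = 1+n≢n (begin
    suc n          ≡⟨ *-identityʳ (suc n) ⟨
    suc n * 1      ≡⟨ ∑-const (suc n) 1 ⟨
    ∑[ u < suc n ] 1 ≡⟨ sum-cong-≗ (λ u → cong [_] (full u)) ⟨
    sum (χ C)      ≡⟨ ∑χC≡n ⟩
    n              ∎)
    where open ≡-Reasoning
  others-in : ∀ {v} → v ∉ₛ C → ∀ u → u ≢ v → u ∈ₛ C
  others-in {v} v∉C u u≢v = [b]≡1⇒b≡true (begin
    χ C u           ≡⟨ +-identityʳ (χ C u) ⟨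
    χ C u + 0       ≡⟨ cong (χ C u +_) (δ-≢ (λ v≡u → u≢v (≡.sym v≡u))) ⟨
    χ C u + δ v u   ≡⟨ tight u ⟩
    1               ∎)
    where
    open ≡-Reasoning
    at-most-one : ∀ u → χ C u + δ v u ≤ 1
    at-most-one u with v ≟ u
    ... | yes refl rewrite v∉C = ≤-refl
    ... | no _ = ≤-trans (≤-reflexive (+-identityʳ _)) ([b]≤1 (lookup C u))
    tight : ∀ u → χ C u + δ v u ≡ 1
    tight = ∑-≤-tight at-most-one (≤-reflexive (begin
      ∑[ u < suc n ] 1                ≡⟨ trans (∑-const (suc n) 1) (*-identityʳ (suc n)) ⟩
      suc n                           ≡⟨ +-comm 1 n ⟩
      n + 1                           ≡⟨ cong₂ _+_ ∑χC≡n (∑-δ-one v) ⟨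
      sum (χ C) + sum (δ v)           ≡⟨ ∑-distrib-+ (χ C) (δ v) ⟨
      ∑[ u < suc n ] (χ C u + δ v u)  ∎))

module Star (v : Fin n) where

  -- The block {v, u} if b holds and the empty block otherwise, so that a star is indexed by all
  -- of Fin n and empty blocks contribute nothing.
  link : Bool → Fin n → Subset n
  link b u = Vec.tabulate (λ x → b ∧ (does (x ≟ v) ∨ does (x ≟ u)))

  star : (Fin n → Bool) → List (Subset n)
  star p = tabulate (λ u → link (p u) u)

  χ-link : ∀ b u x → χ (link b u) x ≡ [ b ∧ (does (x ≟ v) ∨ does (x ≟ u)) ]
  χ-link b u x = cong [_] (lookup∘tabulate _ x)

  χ-link-v : ∀ b u → χ (link b u) v ≡ [ b ]
  χ-link-v b u = trans (χ-link b u v)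
    (trans (cong (λ c → [ b ∧ (c ∨ does (v ≟ u)) ]) (dec-true (v ≟ v) refl)) (cong [_] (∧-identityʳ b)))

  χ-link-≢v : ∀ b u {x} → x ≢ v → χ (link b u) x ≡ δ x u * [ b ]
  χ-link-≢v b u {x} x≢v = begin
    χ (link b u) x                                ≡⟨ χ-link b u x ⟩
    [ b ∧ (does (x ≟ v) ∨ does (x ≟ u)) ]         ≡⟨ cong (λ c → [ b ∧ (c ∨ does (x ≟ u)) ]) (dec-false (x ≟ v) x≢v) ⟩
    [ b ∧ does (x ≟ u) ]                          ≡⟨ [∧] b (does (x ≟ u)) ⟩
    [ b ] * δ x u                                 ≡⟨ *-comm [ b ] (δ x u) ⟩
    δ x u * [ b ]                                 ∎
    where open ≡-Reasoning

  ∈-link : ∀ {b u x} → x ∈ₛ link b u → b ≡ true × (x ≡ v ⊎ x ≡ u)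
  ∈-link {b} {u} {x} x∈ with b | x ≟ v | x ≟ u | trans (≡.sym (lookup∘tabulate _ x)) x∈
  ... | true | yes x≡v | _ | _ = refl , inj₁ x≡v
  ... | true | no _ | yes x≡u | _ = refl , inj₂ x≡u
  ... | true | no _ | no _ | ()
  ... | false | _ | _ | ()

  link-clique : (H : Graph n) {b : Bool} {u : Fin n} → (b ≡ true → Edge H v u) → IsClique H (link b u)
  link-clique H vu x y x∈ y∈ x≢y with ∈-link x∈ | ∈-link y∈
  ... | _ , inj₁ refl | _ , inj₁ refl = ⊥-elim (x≢y refl)
  ... | b≡true , inj₁ refl | _ , inj₂ refl = vu b≡true
  ... | b≡true , inj₂ refl | _ , inj₁ refl = trans (sym H x y) (vu b≡true)
  ... | _ , inj₂ refl | _ , inj₂ refl = ⊥-elim (x≢y refl)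

  pairCount-star-v : ∀ p {j} → j ≢ v → pairCount (star p) v j ≡ [ p j ]
  pairCount-star-v p {j} j≢v = begin
    pairCount (star p) v j                                  ≡⟨ ∑ₗ-tabulate (λ u → link (p u) u) _ ⟩
    ∑[ u < n ] (χ (link (p u) u) v * χ (link (p u) u) j)    ≡⟨ sum-cong-≗ pointwise ⟩
    ∑[ u < n ] (δ j u * [ p u ])                            ≡⟨ ∑-δ j (λ u → [ p u ]) ⟩
    [ p j ]                                                 ∎
    where
    open ≡-Reasoning
    pointwise : ∀ u → χ (link (p u) u) v * χ (link (p u) u) j ≡ δ j u * [ p u ]
    pointwise u = trans (cong₂ _*_ (χ-link-v (p u) u) (χ-link-≢v (p u) u j≢v)) ([b]*[k*[b]]≡k*[b] (p u) (δ j u))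

  pairCount-star-away : ∀ p {i j} → i ≢ v → j ≢ v → i ≢ j → pairCount (star p) i j ≡ 0
  pairCount-star-away p {i} {j} i≢v j≢v i≢j =
    trans (∑ₗ-tabulate (λ u → link (p u) u) _) (∑-zero pointwise)
    where
    pointwise : ∀ u → χ (link (p u) u) i * χ (link (p u) u) j ≡ 0
    pointwise u rewrite χ-link-≢v (p u) u i≢v | χ-link-≢v (p u) u j≢v with i ≟ u
    ... | no _ = refl
    ... | yes refl rewrite δ-≢ (λ j≡i → i≢j (≡.sym j≡i)) = *-zeroʳ (1 * [ p i ])

  weight-star : ∀ p → (∀ u → p u ≡ true → u ≢ v) → weight (star p) ≡ (∑[ u < n ] [ p u ]) * 2
  weight-star p p⇒≢v = begin
    weight (star p)                   ≡⟨ ∑ₗ-tabulate (λ u → link (p u) u) ∣_∣ ⟩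
    ∑[ u < n ] ∣ link (p u) u ∣       ≡⟨ sum-cong-≗ (λ u → ∣link∣ (p u) u (p⇒≢v u)) ⟩
    ∑[ u < n ] ([ p u ] * 2)          ≡⟨ *-distribʳ-sum 2 (λ u → [ p u ]) ⟨
    (∑[ u < n ] [ p u ]) * 2          ∎
    where
    open ≡-Reasoning
    ∣link∣ : ∀ b u → (b ≡ true → u ≢ v) → ∣ link b u ∣ ≡ [ b ] * 2
    ∣link∣ false u _ = trans (∣C∣≡∑χ (link false u)) (∑-zero (λ x → χ-link false u x))
    ∣link∣ true u u≢v = begin
      ∣ link true u ∣                       ≡⟨ ∣C∣≡∑χ (link true u) ⟩
      sum (χ (link true u))                 ≡⟨ sum-cong-≗ v-or-u ⟩
      ∑[ x < n ] (δ x v + δ x u)            ≡⟨ ∑-distrib-+ (λ x → δ x v) (λ x → δ x u) ⟩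
      ∑[ x < n ] δ x v + ∑[ x < n ] δ x u   ≡⟨ cong₂ _+_ (one v) (one u) ⟩
      2                                     ∎
      where
      one : ∀ y → ∑[ x < n ] δ x y ≡ 1
      one y = trans (sum-cong-≗ (λ x → δ-sym x y)) (∑-δ-one y)
      v-or-u : ∀ x → χ (link true u) x ≡ δ x v + δ x u
      v-or-u x rewrite χ-link true u x with x ≟ v | x ≟ u
      ... | yes refl | yes refl = ⊥-elim (u≢v refl refl)
      ... | yes _ | no _ = refl
      ... | no _ | yes _ = refl
      ... | no _ | no _ = refl

  cone-partition : (H : Graph n) {𝒟 : List (Subset n)} → All (IsClique H) 𝒟 → All (v ∉ₛ_) 𝒟 →
    (∀ {i j} → i ≢ v → j ≢ v → Edge H i j → pairCount 𝒟 i j ≡ 1) →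
    IsCliquePartition H (𝒟 ++ star (adj H v))
  cone-partition H {𝒟} cliques avoid-v covers = record
    { allCliques = ++⁺ cliques (tabulate⁺ (λ u → link-clique H (λ vu → vu)))
    ; exactlyOne = λ i j ij →
        trans (countContaining≡pairCount (𝒟 ++ star (adj H v)) i j) (trans (∑ₗ-++ 𝒟 (star (adj H v)) _) (split ij))
    }
    where
    pairCount-𝒟-v : ∀ j → pairCount 𝒟 v j ≡ 0
    pairCount-𝒟-v j = ∑ₗ-zero 𝒟 (λ {L} L∈𝒟 → cong (λ b → [ b ] * χ L j) (All.lookup avoid-v L∈𝒟))
    split : ∀ {i j} → Edge H i j → pairCount 𝒟 i j + pairCount (star (adj H v)) i j ≡ 1
    split {i} {j} ij with i ≟ v | j ≟ v
    ... | yes refl | _ = cong₂ _+_ (pairCount-𝒟-v j) (trans (pairCount-star-v (adj H v) (λ j≡i → edge⇒≢ H ij (≡.sym j≡i))) (cong [_] ij))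
    ... | no i≢v | yes refl = cong₂ _+_ (trans (pairCount-comm 𝒟 i v) (pairCount-𝒟-v i))
        (trans (pairCount-comm (star (adj H v)) i v) (trans (pairCount-star-v (adj H v) i≢v) (cong [_] (trans (sym H v i) ij))))
    ... | no i≢v | no j≢v = cong₂ _+_ (covers i≢v j≢v ij) (pairCount-star-away (adj H v) i≢v j≢v (edge⇒≢ H ij))

weight-stars : (K : Graph (suc n)) (v : Fin (suc n)) →
  weight (Star.star v (adj K v)) + weight (Star.star v (adj (complement K) v)) ≡ n * 2
weight-stars {n} K v = begin
  weight (star (adj K v)) + weight (star (adj Kᶜ v))  ≡⟨ cong₂ _+_ (weight-star (adj K v) (no-loop K))
                                                                    (weight-star (adj Kᶜ v) (no-loop Kᶜ)) ⟩
  deg K v * 2 + deg Kᶜ v * 2                          ≡⟨ *-distribʳ-+ 2 (deg K v) (deg Kᶜ v) ⟨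
  (deg K v + deg Kᶜ v) * 2                            ≡⟨ cong (_* 2) (deg+deg-complement K v) ⟩
  n * 2                                               ∎
  where
  open ≡-Reasoning
  open Star v
  Kᶜ = complement K
  no-loop : (H : Graph (suc n)) → ∀ u → adj H v u ≡ true → u ≢ v
  no-loop H u vu u≡v = edge⇒≢ H vu (≡.sym u≡v)

clique-cone : (K : Graph (suc n)) → HasCliqueOfSize K n →
  ∃[ P ] ∃[ Q ] (IsCliquePartition K P × IsCliquePartition (complement K) Q × weight P + weight Q ≡ 3 * n)
clique-cone {n} K (C , C-clique , ∣C∣≡n) =
  let v , v∉C , others∈C = complement-of-point C ∣C∣≡n in cone-at v v∉C others∈C
  where
  Kᶜ = complement K
  cone-at : (v : Fin (suc n)) → v ∉ₛ C → (∀ u → u ≢ v → u ∈ₛ C) →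
    ∃[ P ] ∃[ Q ] (IsCliquePartition K P × IsCliquePartition Kᶜ Q × weight P + weight Q ≡ 3 * n)
  cone-at v v∉C others∈C = C ∷ star (adj K v) , star (adj Kᶜ v) , P-part , Q-part , total
    where
    open Star v
    P-part : IsCliquePartition K (C ∷ star (adj K v))
    P-part = cone-partition K (C-clique All.∷ All.[]) (v∉C All.∷ All.[]) covered-by-C
      where
      covered-by-C : ∀ {i j} → i ≢ v → j ≢ v → Edge K i j → pairCount (C ∷ []) i j ≡ 1
      covered-by-C {i} {j} i≢v j≢v _ rewrite others∈C i i≢v | others∈C j j≢v = refl
    Q-part : IsCliquePartition Kᶜ (star (adj Kᶜ v))
    Q-part = cone-partition Kᶜ All.[] All.[] no-coedge
      where
      no-coedge : ∀ {i j} → i ≢ v → j ≢ v → Edge Kᶜ i j → pairCount [] i j ≡ 1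
      no-coedge {i} {j} i≢v j≢v ij
        with i≢j ← edge⇒≢ Kᶜ ij
        with () ← trans (≡.sym ij) (adj-complement K i≢j (C-clique i j (others∈C i i≢v) (others∈C j j≢v) i≢j))
    total : ∣ C ∣ + weight (star (adj K v)) + weight (star (adj Kᶜ v)) ≡ 3 * n
    total = begin
      ∣ C ∣ + weight (star (adj K v)) + weight (star (adj Kᶜ v))   ≡⟨ +-assoc ∣ C ∣ _ _ ⟩
      ∣ C ∣ + (weight (star (adj K v)) + weight (star (adj Kᶜ v))) ≡⟨ cong₂ _+_ ∣C∣≡n (weight-stars K v) ⟩
      n + n * 2                                                     ≡⟨ n+2n≡3n n ⟩
      3 * n                                                         ∎
      where
      open ≡-Reasoning
      n+2n≡3n : ∀ n → n + n * 2 ≡ 3 * n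
      n+2n≡3n = solve-∀

cliques-cone : (G : Graph (suc n)) → HasCliqueOfSize G n ⊎ HasCliqueOfSize (complement G) n →
  ∃[ P ] ∃[ Q ] (IsCliquePartition G P × IsCliquePartition (complement G) Q × weight P + weight Q ≡ 3 * n)
cliques-cone G (inj₁ clique) = clique-cone G clique
cliques-cone G (inj₂ coclique) =
  let P , Q , P-part , Q-part , total = clique-cone (complement G) coclique
  in Q , P , IsCliquePartition-cong (complement-involutive G) Q-part , P-part , trans (+-comm (weight Q) (weight P)) total

3[1+n]∸3≡3n : ∀ n → 3 * suc n ∸ 3 ≡ 3 * n
3[1+n]∸3≡3n n = trans (cong (_∸ 3) (3[1+n]≡3n+3 n)) (m+n∸n≡m (3 * n) 3)

mainTheorem3 : (n : ℕ) (G : Graph n) → ¬ IsEmptyGraph G → ¬ IsCompleteGraph G →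
    (a b : ℕ) → IsScp G a → IsScp (complement G) b →
    (3 * n ∸ 3 ≤ a + b)
    × ((a + b ≡ 3 * n ∸ 3) ⇔ (HasCliqueOfSize G (n ∸ 1) ⊎ HasCliqueOfSize (complement G) (n ∸ 1)))
mainTheorem3 zero G nonEmpty _ _ _ _ _ = ⊥-elim (nonEmpty (λ ()))
mainTheorem3 (suc n) G nonEmpty nonComplete _ _ ((P , P-part , refl) , a-minimal) ((Q , Q-part , refl) , b-minimal) =
  let lower , strict-or-clique = partitions-weight-bound G nonEmpty nonComplete P-part Q-part
  in ≡.subst (_≤ W) 3n≡3[1+n]∸3 lower , mk⇔ (equality⇒clique strict-or-clique) (clique⇒equality lower)
  where
  W : ℕ
  W = weight P + weight Q
  Spanning : Set
  Spanning = HasCliqueOfSize G n ⊎ HasCliqueOfSize (complement G) n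
  3n≡3[1+n]∸3 : 3 * n ≡ 3 * suc n ∸ 3
  3n≡3[1+n]∸3 = ≡.sym (3[1+n]∸3≡3n n)
  equality⇒clique : 3 * n < W ⊎ Spanning → W ≡ 3 * suc n ∸ 3 → Spanning
  equality⇒clique (inj₁ 3n<W) W≡3n = ⊥-elim (<-irrefl (≡.sym (trans W≡3n (≡.sym 3n≡3[1+n]∸3))) 3n<W)
  equality⇒clique (inj₂ spanning) _ = spanning
  clique⇒equality : 3 * n ≤ W → Spanning → W ≡ 3 * suc n ∸ 3
  clique⇒equality lower spanning =
    let P′ , Q′ , P′-part , Q′-part , W′≡3n = cliques-cone G spanning
        W≤W′ = +-mono-≤ (a-minimal P′ P′-part) (b-minimal Q′ Q′-part)
    in trans (≤-antisym (≤-trans W≤W′ (≤-reflexive W′≡3n)) lower) 3n≡3[1+n]∸3
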